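{- Let $\Omega$ be a finite set. Then for every $1\leq k\leq|\Omega|$, the $k$-uniform clutter $\mathcal{U}_{k,\Omega}$ is both an $\mathcal{R}_1$-forcing clutter and an $\mathcal{R}_1$-immune clutter; that is, there exist hypergraphs $\mathcal{H}$ and $\mathcal{H}'$ with vertex set $\Omega$ such that $\mathcal{F}_1(\mathcal{H})=\mathcal{U}_{k,\Omega}$ and $\mathcal{I}_1(\mathcal{H}')=\mathcal{U}_{k,\Omega}$.
   Context: For a finite set $\Omega$, $\mathcal{U}_{k,\Omega}=\{A\subseteq\Omega: |A|=k\}$. A hypergraph $\mathcal{H}$ on $\Omega$ has vertex set $\Omega$ and a clutter of hyperedges (subsets of $\Omega$, none containing another). Two vertex subsets $X,Y$ are adjacent if some hyperedge contains both; a vertex $v$ is adjacent to $X$ if $\{v\}$ and $X$ are adjacent. Vertices are colored black or white. Rule $\mathcal{R}_1$: at each step, a non-empty set $X$ of black vertices contained in a hyperedge $E$, such that no white vertex outside $E$ is adjacent to $X$, forces all white vertices of $E$ to become black; iterating until no change is possible from an initial black set $B$ gives a final black set $\mathcal{R}_1^\ast(B)$ independent of the order of steps. An $\mathcal{R}_1$-forcing set is a non-empty $F\subseteq\Omega$ with $\mathcal{R}_1^\ast(F)=\Omega$; an $\mathcal{R}_1$-immune set is a non-empty $I\subseteq\Omega$ with $\mathcal{R}_1^\ast(\Omega\setminus I)=\Omega\setminus I$. $\mathcal{F}_1(\mathcal{H})$ and $\mathcal{I}_1(\mathcal{H})$ denote the families of inclusion-minimal $\mathcal{R}_1$-forcing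 sets and inclusion-minimal $\mathcal{R}_1$-immune sets. -}

module Defs where

open import Data.Nat using (ℕ)
open import Data.Fin using (Fin)
open import Data.Fin.Subset using (Subset; _∈_; _∉_; _⊆_; _⊂_; _∪_; ∁; ⊤; ⁅_⁆; Nonempty; ∣_∣)
open import Data.Product using (Σ; ∃; _×_; _,_)
open import Relation.Binary.PropositionalEquality using (_≡_)
open import Relation.Nullary using (¬_)

-- The finite set Ω is modelled as Fin n; subsets of Ω are Subset n.

Family : ℕ → Set₁
Family n = Subset n → Set

IsClutter : ∀ {n} → Family n → Set
IsClutter {n} 𝓔 = ∀ (E E' : Subset n) → 𝓔 E → 𝓔 E' → E ⊆ E' → E ≡ E'

record Hypergraph (n : ℕ) : Set₁ where
  field
    edge    : Family n
    clutter : IsClutter edge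
open Hypergraph public

Adjacent : ∀ {n} → Hypergraph n → Subset n → Subset n → Set
Adjacent H X Y = ∃ λ E → edge H E × X ⊆ E × Y ⊆ E

AdjacentV : ∀ {n} → Hypergraph n → Fin n → Subset n → Set
AdjacentV H v X = Adjacent H ⁅ v ⁆ X

-- R₁*(B): the final black set obtained by iterating rule R₁ from B.
-- Rule R₁ is monotone (more black vertices never disable a step), so the
-- final set equals the least set containing B closed under the rule:
-- if X is a non-empty set of black vertices contained in a hyperedge E and
-- every vertex outside E adjacent to X is already black (i.e. no white vertex
-- outside E is adjacent to X), then every vertex of E is black.
data R₁* {n : ℕ} (H : Hypergraph n) (B : Subset n) : Fin n → Set where
  initial : ∀ {v} → v ∈ B → R₁* H B v
  force   : ∀ (X E : Subset n) {v} →
            Nonempty X →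
            edge H E →
            X ⊆ E →
            (∀ {x} → x ∈ X → R₁* H B x) →
            (∀ w → w ∉ E → AdjacentV H w X → R₁* H B w) →
            v ∈ E →
            R₁* H B v

Forces : ∀ {n} → Hypergraph n → Subset n → Set
Forces H B = ∀ v → R₁* H B v

-- R₁*(B) = B  (i.e. R₁*(B) ⊆ B; B ⊆ R₁*(B) always holds)
Stalled : ∀ {n} → Hypergraph n → Subset n → Set
Stalled H B = ∀ v → R₁* H B v → v ∈ B

IsForcingSet : ∀ {n} → Hypergraph n → Subset n → Set
IsForcingSet H F = Nonempty F × Forces H F

IsImmuneSet : ∀ {n} → Hypergraph n → Subset n → Set
IsImmuneSet H I = Nonempty I × Stalled H (∁ I)

Minimal : ∀ {n} → Family n → Family n
Minimal {n} P A = P A × (∀ (A' : Subset n) → A' ⊂ A → ¬ P A')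

𝓕₁ : ∀ {n} → Hypergraph n → Family n
𝓕₁ H = Minimal (IsForcingSet H)

𝓘₁ : ∀ {n} → Hypergraph n → Family n
𝓘₁ H = Minimal (IsImmuneSet H)

𝓤 : ∀ {n} → ℕ → Family n
𝓤 k A = ∣ A ∣ ≡ k

_≐_ : ∀ {n} → Family n → Family n → Set
_≐_ {n} P Q = ∀ (A : Subset n) → (P A → Q A) × (Q A → P A)

{-# OPTIONS --safe #-}
-- The complete m-uniform hypergraph forces a black set B in one step as soon as fewer than
-- m vertices are white, and lets no step fire once at least m are white. With m = n − k + 1
-- the R₁-forcing sets are therefore exactly the sets of size ≥ k, and with m = k so are the
-- R₁-immune sets I (which are the white vertices when Ω ∖ I is black); in both cases the
-- minimal ones are the k-sets.
module Submission where

open import Defs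
open import Data.Nat using (ℕ; _≤_)
open import Data.Product using (∃; _×_)

open import Data.Bool.Properties using (not-involutive)
open import Data.Empty using (⊥-elim)
open import Data.Fin as Fin using (Fin)
open import Data.Fin.Properties using (any?)
open import Data.Fin.Subset
open import Data.Fin.Subset.Properties
open import Data.Nat using (suc; _<_; _∸_; z≤n; s≤s; _≤?_)
open import Data.Nat.Properties
open import Data.Product using (_,_)
open import Data.Sum using (_⊎_; inj₁; inj₂)
open import Data.Vec using (_∷_; []; here)
open import Function.Base using (_∘_)
open import Function.Bundles using (_⇔_; mk⇔; module Equivalence)
open import Relation.Binary.PropositionalEquality
open import Relation.Nullary using (¬_; yes; no; contradiction)
open import Relation.Nullary.Decidable using (_×-dec_; ¬?; decidable-stable)

private variable
  n m k : ℕ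
  p q : Subset n

⊈⇒∃∈∉ : ¬ (p ⊆ q) → ∃ λ x → x ∈ p × x ∉ q
⊈⇒∃∈∉ {p = p} {q} p⊈q with any? (λ x → (x ∈? p) ×-dec ¬? (x ∈? q))
... | yes witness = witness
... | no none = ⊥-elim (p⊈q p⊆q)
  where
  p⊆q : p ⊆ q
  p⊆q {x} x∈p = decidable-stable (x ∈? q) (λ x∉q → none (x , x∈p , x∉q))

⊆⇒≡⊎⊂ : p ⊆ q → p ≡ q ⊎ p ⊂ q
⊆⇒≡⊎⊂ {p = p} {q} p⊆q with q ⊆? p
... | yes q⊆p = inj₁ (⊆-antisym p⊆q q⊆p)
... | no q⊈p = inj₂ (p⊆q , ⊈⇒∃∈∉ q⊈p)

⊆∧∣≡∣⇒≡ : p ⊆ q → ∣ p ∣ ≡ ∣ q ∣ → p ≡ q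
⊆∧∣≡∣⇒≡ p⊆q ∣p∣≡∣q∣ with ⊆⇒≡⊎⊂ p⊆q
... | inj₁ p≡q = p≡q
... | inj₂ p⊂q = contradiction ∣p∣≡∣q∣ (<⇒≢ (p⊂q⇒∣p∣<∣q∣ p⊂q))

⊆∧∣<∣⇒⊂ : p ⊆ q → ∣ p ∣ < ∣ q ∣ → p ⊂ q
⊆∧∣<∣⇒⊂ p⊆q ∣p∣<∣q∣ with ⊆⇒≡⊎⊂ p⊆q
... | inj₁ refl = contradiction ∣p∣<∣q∣ (<-irrefl refl)
... | inj₂ p⊂q = p⊂q

∁-involutive : ∀ (p : Subset n) → ∁ (∁ p) ≡ p
∁-involutive [] = refl
∁-involutive (x ∷ p) = cong₂ _∷_ (not-involutive x) (∁-involutive p)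

∣p∣>0⇒Nonempty : ∀ {n} {p : Subset n} → 0 < ∣ p ∣ → Nonempty p
∣p∣>0⇒Nonempty {n} {p} 0<∣p∣ with nonempty? p
... | yes p≠∅ = p≠∅
... | no p≡∅ = contradiction (trans (cong ∣_∣ (Empty-unique p≡∅)) (∣⊥∣≡0 n)) (>⇒≢ 0<∣p∣)

∀∈⇒n≤∣p∣ : ∀ {n} {p : Subset n} → (∀ x → x ∈ p) → n ≤ ∣ p ∣
∀∈⇒n≤∣p∣ {n} {p} x∈p = subst (_≤ ∣ p ∣) (∣⊤∣≡n n) (p⊆q⇒∣p∣≤∣q∣ {p = ⊤} (λ {x} _ → x∈p x))

∣p∪⁅x⁆∣≤1+∣p∣ : ∀ (p : Subset n) x → ∣ p ∪ ⁅ x ⁆ ∣ ≤ suc ∣ p ∣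
∣p∪⁅x⁆∣≤1+∣p∣ (inside ∷ p) Fin.zero = s≤s (m≤n⇒m≤1+n (≤-reflexive (cong ∣_∣ (∪-identityʳ p))))
∣p∪⁅x⁆∣≤1+∣p∣ (outside ∷ p) Fin.zero = s≤s (≤-reflexive (cong ∣_∣ (∪-identityʳ p)))
∣p∪⁅x⁆∣≤1+∣p∣ (inside ∷ p) (Fin.suc x) = s≤s (∣p∪⁅x⁆∣≤1+∣p∣ p x)
∣p∪⁅x⁆∣≤1+∣p∣ (outside ∷ p) (Fin.suc x) = ∣p∪⁅x⁆∣≤1+∣p∣ p x

∃-⊆-between : ∀ (p q : Subset n) m → p ⊆ q → ∣ p ∣ ≤ m → m ≤ ∣ q ∣ →
              ∃ λ r → p ⊆ r × r ⊆ q × ∣ r ∣ ≡ m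
∃-⊆-between [] [] _ _ _ z≤n = [] , ⊆-refl , ⊆-refl , refl
∃-⊆-between (inside ∷ p) (outside ∷ q) m p⊆q _ _ = contradiction (p⊆q here) λ ()
∃-⊆-between (inside ∷ p) (inside ∷ q) (suc m) p⊆q (s≤s ∣p∣≤m) (s≤s m≤∣q∣)
  with ∃-⊆-between p q m (drop-∷-⊆ p⊆q) ∣p∣≤m m≤∣q∣
... | r , p⊆r , r⊆q , ∣r∣≡m = inside ∷ r , s⊆s p⊆r , s⊆s r⊆q , cong suc ∣r∣≡m
∃-⊆-between (outside ∷ p) (outside ∷ q) m p⊆q ∣p∣≤m m≤∣q∣
  with ∃-⊆-between p q m (drop-∷-⊆ p⊆q) ∣p∣≤m m≤∣q∣
... | r , p⊆r , r⊆q , ∣r∣≡m = outside ∷ r , out⊆ p⊆r , out⊆ r⊆q , ∣r∣≡m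
∃-⊆-between (outside ∷ p) (inside ∷ q) m p⊆q ∣p∣≤m m≤1+∣q∣ with m ≤? ∣ q ∣
... | no m≰∣q∣ = inside ∷ q , p⊆q , ⊆-refl , ≤-antisym (≰⇒> m≰∣q∣) m≤1+∣q∣
... | yes m≤∣q∣ with ∃-⊆-between p q m (drop-∷-⊆ p⊆q) ∣p∣≤m m≤∣q∣
...   | r , p⊆r , r⊆q , ∣r∣≡m = outside ∷ r , out⊆ p⊆r , out⊆ r⊆q , ∣r∣≡m

∃-⊇-of-size : ∀ (p : Subset n) → ∣ p ∣ ≤ m → m ≤ n → ∃ λ r → p ⊆ r × ∣ r ∣ ≡ m
∃-⊇-of-size {n} p ∣p∣≤m m≤n with ∃-⊆-between p ⊤ _ ⊆⊤ ∣p∣≤m (subst (_ ≤_) (sym (∣⊤∣≡n n)) m≤n)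
... | r , p⊆r , _ , ∣r∣≡m = r , p⊆r , ∣r∣≡m

∃-⊆-of-size : ∀ (q : Subset n) → m ≤ ∣ q ∣ → ∃ λ r → r ⊆ q × ∣ r ∣ ≡ m
∃-⊆-of-size {n} q m≤∣q∣ with ∃-⊆-between ⊥ q _ ⊥⊆ (subst (_≤ _) (sym (∣⊥∣≡0 n)) z≤n) m≤∣q∣
... | r , _ , r⊆q , ∣r∣≡m = r , r⊆q , ∣r∣≡m

Minimal-≐-𝓤 : ∀ {P : Family n} → (∀ A → P A ⇔ k ≤ ∣ A ∣) → Minimal P ≐ 𝓤 k
Minimal-≐-𝓤 {n} {k} {P} P⇔k≤∣_∣ A = minimal⇒sized , sized⇒minimal
  where
  P⇒k≤ : ∀ {A} → P A → k ≤ ∣ A ∣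
  P⇒k≤ {A} = Equivalence.to (P⇔k≤∣ A ∣)

  k≤⇒P : ∀ {A} → k ≤ ∣ A ∣ → P A
  k≤⇒P {A} = Equivalence.from (P⇔k≤∣ A ∣)

  minimal⇒sized : Minimal P A → ∣ A ∣ ≡ k
  minimal⇒sized (PA , minimal) with m≤n⇒m<n∨m≡n (P⇒k≤ PA)
  ... | inj₂ k≡∣A∣ = sym k≡∣A∣
  ... | inj₁ k<∣A∣ with ∃-⊆-of-size A (<⇒≤ k<∣A∣)
  ...   | A' , A'⊆A , ∣A'∣≡k =
    ⊥-elim (minimal A' (⊆∧∣<∣⇒⊂ A'⊆A (subst (_< ∣ A ∣) (sym ∣A'∣≡k) k<∣A∣))
                       (k≤⇒P (≤-reflexive (sym ∣A'∣≡k))))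

  sized⇒minimal : ∣ A ∣ ≡ k → Minimal P A
  sized⇒minimal ∣A∣≡k = k≤⇒P (≤-reflexive (sym ∣A∣≡k)) , λ A' A'⊂A PA' →
    <⇒≱ (subst (∣ A' ∣ <_) ∣A∣≡k (p⊂q⇒∣p∣<∣q∣ A'⊂A)) (P⇒k≤ PA')

Uniform : ∀ n m → Hypergraph n
Uniform n m = record
  { edge = 𝓤 m
  ; clutter = λ E E' ∣E∣≡m ∣E'∣≡m E⊆E' → ⊆∧∣≡∣⇒≡ E⊆E' (trans ∣E∣≡m (sym ∣E'∣≡m))
  }

edge-through : m ≤ n → ∀ {p : Subset n} → ∣ p ∣ < m → ∀ x → ∃ λ E → 𝓤 m E × p ⊆ E × x ∈ E
edge-through m≤n {p} ∣p∣<m x with ∃-⊇-of-size (p ∪ ⁅ x ⁆) (≤-trans (∣p∪⁅x⁆∣≤1+∣p∣ p x) ∣p∣<m) m≤n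
... | E , p∪x⊆E , ∣E∣≡m = E , ∣E∣≡m , p∪x⊆E ∘ p⊆p∪q _ , p∪x⊆E (q⊆p∪q p _ (x∈⁅x⁆ x))

x∈p⇒⁅x⁆⊆p : ∀ {x} {p : Subset n} → x ∈ p → ⁅ x ⁆ ⊆ p
x∈p⇒⁅x⁆⊆p {x = x} {p} x∈p y∈⁅x⁆ = subst (_∈ p) (sym (x∈⁅y⁆⇒x≡y x y∈⁅x⁆)) x∈p

-- A single step suffices: some edge holds every white vertex together with one black one.
Uniform-forces : m ≤ n → ∀ {B : Subset n} → Nonempty B → ∣ ∁ B ∣ < m → Forces (Uniform n m) B
Uniform-forces m≤n {B} (b , b∈B) ∣∁B∣<m v with v ∈? B | edge-through m≤n ∣∁B∣<m b
... | yes v∈B | _ = initial v∈B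
... | no v∉B | E , ∣E∣≡m , ∁B⊆E , b∈E =
  force ⁅ b ⁆ E (b , x∈⁅x⁆ b) ∣E∣≡m (x∈p⇒⁅x⁆⊆p b∈E)
    (initial ∘ x∈p⇒⁅x⁆⊆p b∈B)
    (λ w w∉E _ → initial (x∉∁p⇒x∈p (w∉E ∘ ∁B⊆E)))
    (∁B⊆E (x∉p⇒x∈∁p v∉B))

-- A step whose edge E contains a white vertex v is blocked: if E held all white vertices
-- it would exceed ∣ ∁ B ∣ ≥ m, and otherwise a white vertex outside E is adjacent to X,
-- because X ⊂ E leaves room for it in an m-edge.
Uniform-stalled : m ≤ n → ∀ {B : Subset n} → m ≤ ∣ ∁ B ∣ → Stalled (Uniform n m) B
Uniform-stalled {m} {n} m≤n {B} m≤∣∁B∣ _ = black⇒∈B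
  where
  black⇒∈B : ∀ {v} → R₁* (Uniform n m) B v → v ∈ B
  black⇒∈B (initial v∈B) = v∈B
  black⇒∈B {v} (force X E (x , x∈X) ∣E∣≡m X⊆E X-black outside-black v∈E) with v ∈? B
  ... | yes v∈B = v∈B
  ... | no v∉B with ∁ B ⊆? E
  ...   | yes ∁B⊆E = contradiction (subst (∣ ∁ B ∣ <_) ∣E∣≡m ∣∁B∣<∣E∣) (≤⇒≯ m≤∣∁B∣)
    where
    ∣∁B∣<∣E∣ : ∣ ∁ B ∣ < ∣ E ∣
    ∣∁B∣<∣E∣ = p⊂q⇒∣p∣<∣q∣ (∁B⊆E , x , X⊆E x∈X , x∈p⇒x∉∁p (black⇒∈B (X-black x∈X)))
  ...   | no ∁B⊈E with ⊈⇒∃∈∉ ∁B⊈E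
  ...     | w , w∈∁B , w∉E with edge-through m≤n ∣X∣<m w
    where
    ∣X∣<m : ∣ X ∣ < m
    ∣X∣<m = subst (∣ X ∣ <_) ∣E∣≡m (p⊂q⇒∣p∣<∣q∣ (X⊆E , v , v∈E , v∉B ∘ black⇒∈B ∘ X-black))
  ...       | E' , ∣E'∣≡m , X⊆E' , w∈E' =
    contradiction (black⇒∈B (outside-black w w∉E (E' , ∣E'∣≡m , x∈p⇒⁅x⁆⊆p w∈E' , X⊆E')))
                  (x∈∁p⇒x∉p w∈∁B)

isForcingSet-Uniform⇔ : 1 ≤ k → k ≤ n → ∀ B →
                         IsForcingSet (Uniform n (suc (n ∸ k))) B ⇔ k ≤ ∣ B ∣
isForcingSet-Uniform⇔ {k} {n} 1≤k k≤n B = mk⇔ forcing⇒large large⇒forcing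
  where
  m≤n : suc (n ∸ k) ≤ n
  m≤n = ∸-monoʳ-< 1≤k k≤n

  forcing⇒large : IsForcingSet (Uniform n (suc (n ∸ k))) B → k ≤ ∣ B ∣
  forcing⇒large (_ , forces) = ≮⇒≥ λ ∣B∣<k →
    let stalled = Uniform-stalled m≤n (subst (_ ≤_) (sym (∣∁p∣≡n∸∣p∣ B)) (∸-monoʳ-< ∣B∣<k k≤n))
    in <⇒≱ ∣B∣<k (≤-trans k≤n (∀∈⇒n≤∣p∣ λ v → stalled v (forces v)))

  large⇒forcing : k ≤ ∣ B ∣ → IsForcingSet (Uniform n (suc (n ∸ k))) B
  large⇒forcing k≤∣B∣ = B≠∅ , Uniform-forces m≤n B≠∅ (s≤s ∣∁B∣≤n∸k)
    where
    B≠∅ : Nonempty B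
    B≠∅ = ∣p∣>0⇒Nonempty (≤-trans 1≤k k≤∣B∣)
    ∣∁B∣≤n∸k : ∣ ∁ B ∣ ≤ n ∸ k
    ∣∁B∣≤n∸k = subst (_≤ n ∸ k) (sym (∣∁p∣≡n∸∣p∣ B)) (∸-monoʳ-≤ n k≤∣B∣)

isImmuneSet-Uniform⇔ : 1 ≤ k → k ≤ n → ∀ I → IsImmuneSet (Uniform n k) I ⇔ k ≤ ∣ I ∣
isImmuneSet-Uniform⇔ {k} {n} 1≤k k≤n I = mk⇔ immune⇒large large⇒immune
  where
  ∣∁∁I∣≡∣I∣ : ∣ ∁ (∁ I) ∣ ≡ ∣ I ∣
  ∣∁∁I∣≡∣I∣ = cong ∣_∣ (∁-involutive I)

  immune⇒large : IsImmuneSet (Uniform n k) I → k ≤ ∣ I ∣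
  immune⇒large ((x , x∈I) , stalled) = ≮⇒≥ λ ∣I∣<k →
    let ∁I≠∅ = ∣p∣>0⇒Nonempty (subst (0 <_) (sym (∣∁p∣≡n∸∣p∣ I)) (m<n⇒0<n∸m (<-≤-trans ∣I∣<k k≤n)))
        forces = Uniform-forces k≤n ∁I≠∅ (subst (_< k) (sym ∣∁∁I∣≡∣I∣) ∣I∣<k)
    in x∈∁p⇒x∉p (stalled x (forces x)) x∈I

  large⇒immune : k ≤ ∣ I ∣ → IsImmuneSet (Uniform n k) I
  large⇒immune k≤∣I∣ = ∣p∣>0⇒Nonempty (≤-trans 1≤k k≤∣I∣) ,
                       Uniform-stalled k≤n (subst (k ≤_) (sym ∣∁∁I∣≡∣I∣) k≤∣I∣)

theorem1 : ∀ (n k : ℕ) → 1 ≤ k → k ≤ n →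
    (∃ λ (H : Hypergraph n) → 𝓕₁ H ≐ 𝓤 k) × (∃ λ (H' : Hypergraph n) → 𝓘₁ H' ≐ 𝓤 k)
theorem1 n k 1≤k k≤n =
  (Uniform n (suc (n ∸ k)) , Minimal-≐-𝓤 (isForcingSet-Uniform⇔ 1≤k k≤n)) ,
  (Uniform n k , Minimal-≐-𝓤 (isImmuneSet-Uniform⇔ 1≤k k≤n))
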